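{- For a positive integer $m$ let $\tau(m)$ denote the number of positive divisors of $m$, and for positive integers $n$ define $f(n):=\sum_{1\le k\le n} \tau(2^k-1)$. Then $$\limsup_{n\to\infty} \frac{f(2n)}{f(n)}=\infty,$$ i.e., the sequence $(f(2n)/f(n))_{n\ge 1}$ is unbounded.
   Context: $\tau(m)$ is the number of positive divisors of $m$; $f(n)$ is the total number of divisors of the first $n$ Mersenne numbers $2^k-1$. -}

module Defs where

open import Data.Nat using (ℕ; zero; suc; _+_; _∸_; _^_)
open import Data.Nat.Divisibility using (_∣?_)
open import Data.List using (List; length; filter; upTo; map)
open import Data.Nat.ListAction using (sum)

τ : ℕ → ℕ
τ m = length (filter (λ d → d ∣? m) (map suc (upTo m)))

f : ℕ → ℕ
f n = sum (map (λ k → τ (2 ^ suc k ∸ 1)) (upTo n))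

-- For k ≥ 1 let Φ k = 2^(2k) − 2^k + 1 = Φ₆(2^k); it divides 2^(6k) − 1. Any common
-- divisor d of Φ k and 2^(3k) − 1 divides 2, and of Φ k and 2^(2k) − 1 divides 3.
-- Taking k = 2^(i+1)·3^j for 0 ≤ i, j < K, the gcd of the exponents 6k, 6k′ of two
-- distinct members divides 3k′ or 2k′ (by comparing the powers of 2 and of 3), so
-- the K² numbers Φ k are pairwise coprime, odd and not divisible by 3 (k is even),
-- and all divide 2^M − 1 with M = 2^(K+1)·3^K < 2^(3K+1). Hence
-- τ(2^M − 1) ≥ 2^(K²), and f(2^(3K+1)) ≥ 2^(K²). If f(2n) ≤ C·f(n) for all n ≥ 1,
-- then f(2^J) ≤ C^J ≤ 2^(CJ), which is too small for J = 3K + 1 and K = 3C + 1.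
module Submission where

open import Defs
open import Data.Nat
open import Data.Nat.Properties
open import Data.Nat.Divisibility
open import Data.Nat.Coprimality using (Coprime; coprime-divisor; coprime⇒gcd≡1)
import Data.Nat.Coprimality as Coprime
open import Data.Nat.GCD using (gcd; gcd-GCD; module Bézout; c*gcd[m,n]≡gcd[cm,cn])
open import Data.Nat.ListAction using (sum; product)
open import Data.Nat.ListAction.Properties using (product≢0)
open import Data.Nat.Tactic.RingSolver using (solve-∀)
open import Data.Product using (∃-syntax; _×_; _,_; proj₂; uncurry)
open import Data.Sum using (_⊎_; inj₁; inj₂; fromInj₁)
open import Data.Empty using (⊥-elim)
open import Data.List using (List; []; _∷_; length; filter; upTo; map; _++_; cartesianProduct)
open import Data.List.Properties using (filter-notAll; length-++; length-map; length-upTo)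
open import Data.List.Membership.Propositional using (_∈_)
open import Data.List.Membership.Propositional.Properties
open import Data.List.Relation.Binary.Subset.Propositional using (_⊆_)
open import Data.List.Relation.Unary.Any using (here; there)
import Data.List.Relation.Unary.Any as Any
open import Data.List.Relation.Unary.All using (All; []; _∷_)
import Data.List.Relation.Unary.All as All
import Data.List.Relation.Unary.All.Properties as All
open import Data.List.Relation.Unary.AllPairs using (AllPairs; []; _∷_)
import Data.List.Relation.Unary.AllPairs as AllPairs
import Data.List.Relation.Unary.AllPairs.Properties as AllPairs
open import Data.List.Relation.Unary.Unique.Propositional using (Unique)
import Data.List.Relation.Unary.Unique.Propositional.Properties as Unique
open import Relation.Nullary using (¬_; ¬?; yes; no)
open import Relation.Binary.Definitions using (tri<; tri≈; tri>)
open import Relation.Binary.PropositionalEquality using (_≡_; _≢_; refl; sym; trans; cong; cong₂; subst; subst₂; module ≡-Reasoning)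

Mer : ℕ → ℕ
Mer n = 2 ^ n ∸ 1

suc-Mer : ∀ n → suc (Mer n) ≡ 2 ^ n
suc-Mer n = m+[n∸m]≡n (m^n>0 2 n)

Mer-+ : ∀ m n → Mer (m + n) ≡ 2 ^ n * Mer m + Mer n
Mer-+ m n = suc-injective (begin
  suc (Mer (m + n))                 ≡⟨ suc-Mer (m + n) ⟩
  2 ^ (m + n)                       ≡⟨ ^-distribˡ-+-* 2 m n ⟩
  2 ^ m * 2 ^ n                     ≡⟨ cong₂ _*_ (sym (suc-Mer m)) (sym (suc-Mer n)) ⟩
  suc (Mer m) * suc (Mer n)         ≡⟨ expand (Mer m) (Mer n) ⟩
  suc (suc (Mer n) * Mer m + Mer n) ≡⟨ cong (λ t → suc (t * Mer m + Mer n)) (suc-Mer n) ⟩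
  suc (2 ^ n * Mer m + Mer n)       ∎)
  where
  open ≡-Reasoning
  expand : ∀ a b → (1 + a) * (1 + b) ≡ 1 + ((1 + b) * a + b)
  expand = solve-∀

Mer∣Mer[*] : ∀ q m → Mer m ∣ Mer (q * m)
Mer∣Mer[*] zero    m = Mer m ∣0
Mer∣Mer[*] (suc q) m = subst (Mer m ∣_) (sym (Mer-+ m (q * m)))
  (∣m∣n⇒∣m+n (n∣m*n (2 ^ (q * m))) (Mer∣Mer[*] q m))

Mer-mono-∣ : ∀ {m n} → m ∣ n → Mer m ∣ Mer n
Mer-mono-∣ {m} (divides q refl) = Mer∣Mer[*] q m

Mer-poly : ∀ k m (p : ℕ → ℕ) → (∀ z → suc z ^ m ≡ suc (p z)) → Mer (k * m) ≡ p (Mer k)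
Mer-poly k m p expand = suc-injective (begin
  suc (Mer (k * m)) ≡⟨ suc-Mer (k * m) ⟩
  2 ^ (k * m)       ≡⟨ ^-*-assoc 2 k m ⟨
  (2 ^ k) ^ m       ≡⟨ cong (_^ m) (suc-Mer k) ⟨
  suc (Mer k) ^ m   ≡⟨ expand (Mer k) ⟩
  suc (p (Mer k))   ∎)
  where open ≡-Reasoning

Mer[2k] : ∀ k → Mer (k * 2) ≡ Mer k * (Mer k + 2)
Mer[2k] k = Mer-poly k 2 (λ z → z * (z + 2)) expand
  where
  expand : ∀ z → (1 + z) * ((1 + z) * 1) ≡ 1 + z * (z + 2)
  expand = solve-∀

Mer[3k] : ∀ k → Mer (k * 3) ≡ Mer k * (Mer k * Mer k + 3 * Mer k + 3)
Mer[3k] k = Mer-poly k 3 (λ z → z * (z * z + 3 * z + 3)) expand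
  where
  expand : ∀ z → (1 + z) * ((1 + z) * ((1 + z) * 1)) ≡ 1 + z * (z * z + 3 * z + 3)
  expand = solve-∀

coprime-* : ∀ {m n o} → Coprime m n → Coprime m o → Coprime m (n * o)
coprime-* {n = n} m⊥n m⊥o {d} (d∣m , d∣no) = m⊥o (d∣m , coprime-divisor d⊥n d∣no)
  where
  d⊥n : Coprime d n
  d⊥n (c∣d , c∣n) = m⊥n (∣-trans c∣d d∣m , c∣n)

coprime-^ : ∀ {m n} k → Coprime m n → Coprime m (n ^ k)
coprime-^ zero    _   = Coprime.sym (Coprime.1-coprimeTo _)
coprime-^ (suc k) m⊥n = coprime-* m⊥n (coprime-^ k m⊥n)

coprime-suc : ∀ {m n} → m ∣ n → Coprime (suc n) m
coprime-suc {n = n} m∣n {c} (c∣1+n , c∣m) =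
  ∣1⇒≡1 (∣m+n∣m⇒∣n (subst (c ∣_) (+-comm 1 n) c∣1+n) (∣-trans c∣m m∣n))

3⊥2 : Coprime 3 2
3⊥2 = coprime-suc (∣-refl {2})

∣Mer[m+n]⇒∣Mer[m] : ∀ {d} m n → Coprime d 2 → d ∣ Mer (m + n) → d ∣ Mer n → d ∣ Mer m
∣Mer[m+n]⇒∣Mer[m] {d} m n d⊥2 d∣m+n d∣n = coprime-divisor (coprime-^ n d⊥2)
  (∣m+n∣m⇒∣n (subst (d ∣_) (trans (Mer-+ m n) (+-comm _ (Mer n))) d∣m+n) d∣n)

∣Mer⇒∣Mer[gcd] : ∀ {d} m n → Coprime d 2 → d ∣ Mer m → d ∣ Mer n → d ∣ Mer (gcd m n)
∣Mer⇒∣Mer[gcd] {d} m n d⊥2 d∣m d∣n with Bézout.identity (gcd-GCD m n)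
... | Bézout.+- x y eq = ∣Mer[m+n]⇒∣Mer[m] (gcd m n) (y * n) d⊥2
  (subst (λ t → d ∣ Mer t) (sym eq) (∣-trans d∣m (Mer∣Mer[*] x m))) (∣-trans d∣n (Mer∣Mer[*] y n))
... | Bézout.-+ x y eq = ∣Mer[m+n]⇒∣Mer[m] (gcd m n) (x * m) d⊥2
  (subst (λ t → d ∣ Mer t) (sym eq) (∣-trans d∣n (Mer∣Mer[*] y n))) (∣-trans d∣m (Mer∣Mer[*] x m))

∣Mer[n*a]⇒∣Mer[n] : ∀ {d a b} n → Coprime d 2 → Coprime a b →
                    d ∣ Mer (n * a) → d ∣ Mer (n * b) → d ∣ Mer n
∣Mer[n*a]⇒∣Mer[n] {d} {a} {b} n d⊥2 a⊥b d∣na d∣nb =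
  subst (λ t → d ∣ Mer t) gcd[na,nb]≡n (∣Mer⇒∣Mer[gcd] (n * a) (n * b) d⊥2 d∣na d∣nb)
  where
  gcd[na,nb]≡n : gcd (n * a) (n * b) ≡ n
  gcd[na,nb]≡n = trans (sym (c*gcd[m,n]≡gcd[cm,cn] n a b))
                       (trans (cong (n *_) (coprime⇒gcd≡1 a⊥b)) (*-identityʳ n))

-- Φ k = Φ₆(2^k) = 2^(2k) − 2^k + 1, written without truncated subtraction.
Φ : ℕ → ℕ
Φ k = suc (Mer k * 2 ^ k)

Φ-poly : ∀ k → Φ k ≡ suc (Mer k * suc (Mer k))
Φ-poly k = cong (λ t → suc (Mer k * t)) (sym (suc-Mer k))

Mer[3k]+2≡[Mer+2]*Φ : ∀ k → Mer (k * 3) + 2 ≡ (Mer k + 2) * Φ k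
Mer[3k]+2≡[Mer+2]*Φ k = begin
  Mer (k * 3) + 2                          ≡⟨ cong (_+ 2) (Mer[3k] k) ⟩
  z * (z * z + 3 * z + 3) + 2              ≡⟨ factor z ⟩
  (z + 2) * (1 + z * (1 + z))              ≡⟨ cong ((z + 2) *_) (Φ-poly k) ⟨
  (z + 2) * Φ k                            ∎
  where
  open ≡-Reasoning
  z = Mer k
  factor : ∀ z → z * (z * z + 3 * z + 3) + 2 ≡ (z + 2) * (1 + z * (1 + z))
  factor = solve-∀

Φ*[Mer+3]≡Mer[2k]*[Mer+2]+3 : ∀ k → Φ k * (Mer k + 3) ≡ Mer (k * 2) * (Mer k + 2) + 3
Φ*[Mer+3]≡Mer[2k]*[Mer+2]+3 k = begin
  Φ k * (z + 3)                   ≡⟨ cong (_* (z + 3)) (Φ-poly k) ⟩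
  (1 + z * (1 + z)) * (z + 3)     ≡⟨ expand z ⟩
  z * (z + 2) * (z + 2) + 3       ≡⟨ cong (λ t → t * (z + 2) + 3) (Mer[2k] k) ⟨
  Mer (k * 2) * (z + 2) + 3       ∎
  where
  open ≡-Reasoning
  z = Mer k
  expand : ∀ z → (1 + z * (1 + z)) * (z + 3) ≡ z * (z + 2) * (z + 2) + 3
  expand = solve-∀

-- 2^(6k) − 1 = (2^(3k) − 1)(2^(3k) + 1) and 2^(3k) + 1 = (2^k + 1) Φ k.
Φ∣Mer[6k] : ∀ k → Φ k ∣ Mer (k * 6)
Φ∣Mer[6k] k = subst (Φ k ∣_) Mer[6k]≡ (∣n⇒∣m*n (Mer (k * 3)) Φ∣Mer[3k]+2)
  where
  Φ∣Mer[3k]+2 : Φ k ∣ Mer (k * 3) + 2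
  Φ∣Mer[3k]+2 = subst (Φ k ∣_) (sym (Mer[3k]+2≡[Mer+2]*Φ k)) (n∣m*n (Mer k + 2))
  Mer[6k]≡ : Mer (k * 3) * (Mer (k * 3) + 2) ≡ Mer (k * 6)
  Mer[6k]≡ = trans (sym (Mer[2k] (k * 3))) (cong Mer (*-assoc k 3 2))

∣Φ⇒∣Mer[3k]⇒∣2 : ∀ {d} k → d ∣ Φ k → d ∣ Mer (k * 3) → d ∣ 2
∣Φ⇒∣Mer[3k]⇒∣2 {d} k d∣Φ d∣Mer = ∣m+n∣m⇒∣n
  (subst (d ∣_) (sym (Mer[3k]+2≡[Mer+2]*Φ k)) (∣n⇒∣m*n (Mer k + 2) d∣Φ)) d∣Mer

∣Φ⇒∣Mer[2k]⇒∣3 : ∀ {d} k → d ∣ Φ k → d ∣ Mer (k * 2) → d ∣ 3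
∣Φ⇒∣Mer[2k]⇒∣3 {d} k d∣Φ d∣Mer = ∣m+n∣m⇒∣n
  (subst (d ∣_) (Φ*[Mer+3]≡Mer[2k]*[Mer+2]+3 k) (∣m⇒∣m*n (Mer k + 3) d∣Φ)) (∣m⇒∣m*n (Mer k + 2) d∣Mer)

Mer>0 : ∀ {k} → 0 < k → 0 < Mer k
Mer>0 {k} k>0 = ≤-pred (subst (2 ≤_) (sym (suc-Mer k)) (^-monoʳ-≤ 2 k>0))

Φ≥2 : ∀ {k} → 0 < k → 2 ≤ Φ k
Φ≥2 {k} k>0 = s≤s (≤-trans (Mer>0 k>0) (m≤m*n (Mer k) (2 ^ k) {{m^n≢0 2 k}}))

Φ⊥2 : ∀ {k} → 0 < k → Coprime (Φ k) 2
Φ⊥2 {suc k} _ = coprime-suc (∣n⇒∣m*n (Mer (suc k)) (m∣m*n (2 ^ k)))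

Φ⊥3 : ∀ {k} → 2 ∣ k → Coprime (Φ k) 3
Φ⊥3 {k} 2∣k = coprime-suc (∣m⇒∣m*n (2 ^ k) (Mer-mono-∣ 2∣k))

E : ℕ → ℕ → ℕ
E i j = 2 ^ suc i * 3 ^ j

A : ℕ → ℕ → ℕ
A i j = Φ (E i j)

E>0 : ∀ i j → 0 < E i j
E>0 i j = >-nonZero⁻¹ (E i j) {{m*n≢0 (2 ^ suc i) (3 ^ j) {{m^n≢0 2 (suc i)}} {{m^n≢0 3 j}}}}

^-monoʳ-∣ : ∀ m {a b} → a ≤ b → m ^ a ∣ m ^ b
^-monoʳ-∣ m {a} a≤b with k , refl ← m≤n⇒∃[o]m+o≡n a≤b =
  subst (m ^ a ∣_) (sym (^-distribˡ-+-* m a k)) (m∣m*n (m ^ k))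

2^3^-mono-∣ : ∀ {a b a′ b′} → a ≤ a′ → b ≤ b′ → 2 ^ a * 3 ^ b ∣ 2 ^ a′ * 3 ^ b′
2^3^-mono-∣ a≤a′ b≤b′ = *-pres-∣ (^-monoʳ-∣ 2 a≤a′) (^-monoʳ-∣ 3 b≤b′)

E*6≡ : ∀ i j → E i j * 6 ≡ 2 ^ (2 + i) * 3 ^ (1 + j)
E*6≡ i j = regroup (2 ^ i) (3 ^ j)
  where regroup : ∀ x y → 2 * x * y * 6 ≡ 2 * (2 * x) * (3 * y)
        regroup = solve-∀

E*6∣E : ∀ {i j i′ j′} → i < i′ → j < j′ → E i j * 6 ∣ E i′ j′
E*6∣E {i} {j} {i′} {j′} i<i′ j<j′ = subst (_∣ E i′ j′) (sym (E*6≡ i j)) (2^3^-mono-∣ (s≤s i<i′) j<j′)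

E*6∣E*3*3^ : ∀ {i i′} j j′ → i < i′ → E i j * 6 ∣ E i′ j′ * 3 * 3 ^ j
E*6∣E*3*3^ {i} {i′} j j′ i<i′ = subst₂ _∣_ (sym (E*6≡ i j)) (sym rhs≡)
  (2^3^-mono-∣ (s≤s i<i′) (s≤s (m≤n+m j j′)))
  where
  regroup : ∀ x y w → x * y * 3 * w ≡ x * (3 * y * w)
  regroup = solve-∀
  rhs≡ : E i′ j′ * 3 * 3 ^ j ≡ 2 ^ suc i′ * 3 ^ (suc j′ + j)
  rhs≡ = trans (regroup (2 ^ suc i′) (3 ^ j′) (3 ^ j))
               (cong (2 ^ suc i′ *_) (sym (^-distribˡ-+-* 3 (suc j′) j)))

E*6∣E*2*2^ : ∀ i {j j′} i′ → j < j′ → E i j * 6 ∣ E i′ j′ * 2 * 2 ^ i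
E*6∣E*2*2^ i {j} {j′} i′ j<j′ = subst₂ _∣_ (sym (E*6≡ i j)) (sym rhs≡)
  (2^3^-mono-∣ (s≤s (s≤s (m≤n+m i i′))) j<j′)
  where
  regroup : ∀ x y w → 2 * x * y * 2 * w ≡ 2 * (2 * (x * w)) * y
  regroup = solve-∀
  rhs≡ : E i′ j′ * 2 * 2 ^ i ≡ 2 ^ (2 + (i′ + i)) * 3 ^ j′
  rhs≡ = trans (regroup (2 ^ i′) (3 ^ j′) (2 ^ i))
               (cong (λ t → 2 * (2 * t) * 3 ^ j′) (sym (^-distribˡ-+-* 2 i′ i)))

-- A common divisor d is odd, and divides 2^g − 1 for g = gcd(6E, 6E′); g divides 3E′
-- (if i < i′) or 2E′ (if j < j′), and then Φ E′ forces d ∣ 2 resp. d ∣ 3.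
A-coprime : ∀ {i j i′ j′} → i < i′ ⊎ j < j′ → Coprime (A i j) (A i′ j′)
A-coprime {i} {j} {i′} {j′} i<i′⊎j<j′ {d} (d∣A , d∣A′) = d≡1 i<i′⊎j<j′
  where
  E′ = E i′ j′
  d⊥2 : Coprime d 2
  d⊥2 (c∣d , c∣2) = Φ⊥2 (E>0 i j) (∣-trans c∣d d∣A , c∣2)
  d∣Mer[6E] : d ∣ Mer (E i j * 6)
  d∣Mer[6E] = ∣-trans d∣A (Φ∣Mer[6k] (E i j))
  d∣Mer[6E′] : d ∣ Mer (E′ * 6)
  d∣Mer[6E′] = ∣-trans d∣A′ (Φ∣Mer[6k] E′)
  d≡1 : i < i′ ⊎ j < j′ → d ≡ 1
  d≡1 (inj₁ i<i′) = Φ⊥2 (E>0 i′ j′) (d∣A′ , ∣Φ⇒∣Mer[3k]⇒∣2 E′ d∣A′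
    (∣Mer[n*a]⇒∣Mer[n] (E′ * 3) d⊥2 (coprime-^ j (Coprime.sym 3⊥2))
      (subst (λ t → d ∣ Mer t) (sym (*-assoc E′ 3 2)) d∣Mer[6E′])
      (∣-trans d∣Mer[6E] (Mer-mono-∣ (E*6∣E*3*3^ j j′ i<i′)))))
  d≡1 (inj₂ j<j′) = Φ⊥3 (∣m⇒∣m*n (3 ^ j′) (m∣m*n (2 ^ i′))) (d∣A′ , ∣Φ⇒∣Mer[2k]⇒∣3 E′ d∣A′
    (∣Mer[n*a]⇒∣Mer[n] (E′ * 2) d⊥2 (coprime-^ i 3⊥2)
      (subst (λ t → d ∣ Mer t) (sym (*-assoc E′ 2 3)) d∣Mer[6E′])
      (∣-trans d∣Mer[6E] (Mer-mono-∣ (E*6∣E*2*2^ i i′ j<j′)))))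

A-coprime-≢ : ∀ {i j i′ j′} → (i , j) ≢ (i′ , j′) → Coprime (A i j) (A i′ j′)
A-coprime-≢ {i} {j} {i′} {j′} ≢ with <-cmp i i′ | <-cmp j j′
... | tri< i<i′ _ _ | _             = A-coprime {i} {j} {i′} {j′} (inj₁ i<i′)
... | _             | tri< j<j′ _ _ = A-coprime {i} {j} {i′} {j′} (inj₂ j<j′)
... | tri> _ _ i>i′ | _             = Coprime.sym (A-coprime {i′} {j′} {i} {j} (inj₁ i>i′))
... | _             | tri> _ _ j>j′ = Coprime.sym (A-coprime {i′} {j′} {i} {j} (inj₂ j>j′))
... | tri≈ _ refl _ | tri≈ _ refl _ = ⊥-elim (≢ refl)

Unique-⊆⇒length≤ : ∀ {xs ys : List ℕ} → Unique xs → xs ⊆ ys → length xs ≤ length ys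
Unique-⊆⇒length≤ {[]}     _             _     = z≤n
Unique-⊆⇒length≤ {x ∷ xs} {ys} (x∉xs ∷ xs!) xs⊆ys = begin
  suc (length xs)               ≤⟨ s≤s (Unique-⊆⇒length≤ xs! xs⊆ys-x) ⟩
  suc (length (filter ≢x? ys))  ≤⟨ filter-notAll ≢x? ys (Any.map (λ x≡y x≢y → x≢y x≡y) (xs⊆ys (here refl))) ⟩
  length ys                     ∎
  where
  open ≤-Reasoning
  ≢x? = λ y → ¬? (x ≟ y)
  xs⊆ys-x : xs ⊆ filter ≢x? ys
  xs⊆ys-x y∈xs = ∈-filter⁺ ≢x? (xs⊆ys (there y∈xs)) (All.lookup x∉xs y∈xs)

divisors : ℕ → List ℕ
divisors m = filter (_∣? m) (map suc (upTo m))

Unique-divisors : ∀ m → Unique (divisors m)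
Unique-divisors m = Unique.filter⁺ (_∣? m) (Unique.map⁺ suc-injective (Unique.upTo⁺ m))

∈-divisors⁻ : ∀ {m x} → x ∈ divisors m → x ∣ m
∈-divisors⁻ {m} x∈ = proj₂ (∈-filter⁻ (_∣? m) {xs = map suc (upTo m)} x∈)

∈-divisors⁺ : ∀ {m x} → .{{NonZero m}} → x ∣ m → x ∈ divisors m
∈-divisors⁺ {m} {zero}  0∣m = ⊥-elim (≢-nonZero⁻¹ m (0∣⇒≡0 0∣m))
∈-divisors⁺ {m} {suc x} x∣m = ∈-filter⁺ (_∣? m) (∈-map⁺ suc (∈-upTo⁺ (∣⇒≤ x∣m))) x∣m

Unique-∣⇒length≤τ : ∀ {xs N} → .{{NonZero N}} → Unique xs → All (_∣ N) xs → length xs ≤ τ N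
Unique-∣⇒length≤τ xs! xs∣N = Unique-⊆⇒length≤ xs! (λ x∈xs → ∈-divisors⁺ (All.lookup xs∣N x∈xs))

τ-mono-∣ : ∀ {a N} → .{{NonZero N}} → a ∣ N → τ a ≤ τ N
τ-mono-∣ {a} a∣N = Unique-∣⇒length≤τ (Unique-divisors a)
  (All.tabulate (λ x∈ → ∣-trans (∈-divisors⁻ x∈) a∣N))

-- The divisors x of a and x·b of a·b are all distinct because b > 1 is coprime to a.
τ-*-coprime : ∀ {a b} → .{{NonZero a}} → Coprime a b → 2 ≤ b → τ a + τ a ≤ τ (a * b)
τ-*-coprime {a} {b@(suc _)} a⊥b b≥2 = subst (_≤ τ (a * b)) length≡
  (Unique-∣⇒length≤τ {{m*n≢0 a b}} (Unique.++⁺ (Unique-divisors a) (Unique.map⁺ (*-cancelʳ-≡ _ _ b) {ds} (Unique-divisors a)) disjoint)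
    (All.++⁺ (All.map (∣m⇒∣m*n b) ds∣a) (All.map⁺ (All.map (*-monoˡ-∣ b) ds∣a))))
  where
  ds = divisors a
  ds∣a : All (_∣ a) ds
  ds∣a = All.tabulate ∈-divisors⁻
  disjoint : ∀ {v} → ¬ (v ∈ ds × v ∈ map (_* b) ds)
  disjoint (v∈ , v∈ds*b) with x , _ , refl ← ∈-map⁻ (_* b) v∈ds*b =
    <-irrefl (sym (a⊥b (m*n∣⇒n∣ x b (∈-divisors⁻ v∈) , ∣-refl))) b≥2
  length≡ : length (ds ++ map (_* b) ds) ≡ τ a + τ a
  length≡ = trans (length-++ ds) (cong (τ a +_) (length-map (_* b) ds))

coprime-product : ∀ {m ns} → All (Coprime m) ns → Coprime m (product ns)
coprime-product []             = Coprime.sym (Coprime.1-coprimeTo _)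
coprime-product (m⊥n ∷ m⊥ns) = coprime-* m⊥n (coprime-product m⊥ns)

coprime-∣⇒*-∣ : ∀ {m n o} → Coprime m n → m ∣ o → n ∣ o → m * n ∣ o
coprime-∣⇒*-∣ {m} {n} m⊥n (divides q refl) n∣qm
  with divides r refl ← coprime-divisor (Coprime.sym m⊥n) (subst (n ∣_) (*-comm q m) n∣qm) =
  divides r (trans (*-assoc r n m) (cong (r *_) (*-comm n m)))

product-∣ : ∀ {ns o} → AllPairs Coprime ns → All (_∣ o) ns → product ns ∣ o
product-∣ []               []            = 1∣ _
product-∣ (n⊥ns ∷ ns-cop) (n∣o ∷ ns∣o) =
  coprime-∣⇒*-∣ (coprime-product n⊥ns) n∣o (product-∣ ns-cop ns∣o)

2^length≤τ[product] : ∀ {ns} → AllPairs Coprime ns → All (2 ≤_) ns → 2 ^ length ns ≤ τ (product ns)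
2^length≤τ[product] []               []            = ≤-refl
2^length≤τ[product] {n ∷ ns} (n⊥ns ∷ ns-cop) (n≥2 ∷ ns≥2) = begin
  2 ^ suc (length ns)             ≡⟨ cong (2 ^ length ns +_) (+-identityʳ _) ⟩
  2 ^ length ns + 2 ^ length ns   ≤⟨ +-mono-≤ ih ih ⟩
  τ (product ns) + τ (product ns) ≤⟨ τ-*-coprime {{product≢0 (All.map (λ m≥2 → >-nonZero (<-≤-trans z<s m≥2)) ns≥2)}}
                                       (Coprime.sym (coprime-product n⊥ns)) n≥2 ⟩
  τ (product ns * n)              ≡⟨ cong τ (*-comm (product ns) n) ⟩
  τ (n * product ns)              ∎
  where
  open ≤-Reasoning
  ih = 2^length≤τ[product] ns-cop ns≥2

length-cartesianProduct : ∀ {a b} {A : Set a} {B : Set b} (xs : List A) (ys : List B) →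
                          length (cartesianProduct xs ys) ≡ length xs * length ys
length-cartesianProduct []       ys = refl
length-cartesianProduct (x ∷ xs) ys = trans (length-++ (map (x ,_) ys))
  (cong₂ _+_ (length-map (x ,_) ys) (length-cartesianProduct xs ys))

factors : ℕ → List ℕ
factors K = map (uncurry A) (cartesianProduct (upTo K) (upTo K))

2^[K*K]≤τ[Mer[E]] : ∀ K → 2 ^ (K * K) ≤ τ (Mer (E K K))
2^[K*K]≤τ[Mer[E]] K = begin
  2 ^ (K * K)             ≡⟨ cong (2 ^_) length≡ ⟨
  2 ^ length (factors K)  ≤⟨ 2^length≤τ[product] coprime ≥2 ⟩
  τ (product (factors K)) ≤⟨ τ-mono-∣ {{>-nonZero (Mer>0 (E>0 K K))}} (product-∣ coprime ∣Mer) ⟩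
  τ (Mer (E K K))         ∎
  where
  open ≤-Reasoning
  pairs = cartesianProduct (upTo K) (upTo K)
  length≡ : length (factors K) ≡ K * K
  length≡ = trans (length-map (uncurry A) pairs) (trans (length-cartesianProduct (upTo K) (upTo K))
                  (cong₂ _*_ (length-upTo K) (length-upTo K)))
  coprime : AllPairs Coprime (factors K)
  coprime = AllPairs.map⁺ (AllPairs.map A-coprime-≢ (Unique.cartesianProduct⁺ (Unique.upTo⁺ K) (Unique.upTo⁺ K)))
  ≥2 : All (2 ≤_) (factors K)
  ≥2 = All.map⁺ (All.tabulate (λ {(i , j)} _ → Φ≥2 (E>0 i j)))
  ∣Mer : All (_∣ Mer (E K K)) (factors K)
  ∣Mer = All.map⁺ (All.tabulate λ {(i , j)} ij∈ →
    let i∈ , j∈ = ∈-cartesianProduct⁻ (upTo K) (upTo K) ij∈ in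
    ∣-trans (Φ∣Mer[6k] (E i j)) (Mer-mono-∣ (E*6∣E (∈-upTo⁻ i∈) (∈-upTo⁻ j∈))))

∈⇒≤sum : ∀ {n ns} → n ∈ ns → n ≤ sum ns
∈⇒≤sum {ns = m ∷ ms} (here refl) = m≤m+n m (sum ms)
∈⇒≤sum {ns = m ∷ ms} (there n∈) = ≤-trans (∈⇒≤sum n∈) (m≤n+m (sum ms) m)

τ[Mer]≤f : ∀ {k n} → 0 < k → k ≤ n → τ (Mer k) ≤ f n
τ[Mer]≤f {suc k} _ k<n = ∈⇒≤sum (∈-map⁺ (λ k → τ (2 ^ suc k ∸ 1)) (∈-upTo⁺ k<n))

doubling-or-bound : ∀ C J → (∃[ n ] (n ≥ 1 × C * f n < f (2 * n))) ⊎ f (2 ^ J) ≤ C ^ J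
doubling-or-bound C zero = inj₂ ≤-refl
doubling-or-bound C (suc J) with doubling-or-bound C J
... | inj₁ witness = inj₁ witness
... | inj₂ f≤C^J with C * f (2 ^ J) <? f (2 * 2 ^ J)
...   | yes jump = inj₁ (2 ^ J , m^n>0 2 J , jump)
...   | no ¬jump = inj₂ (≤-trans (≮⇒≥ ¬jump) (*-monoʳ-≤ C f≤C^J))

n≤2^n : ∀ n → n ≤ 2 ^ n
n≤2^n zero    = z≤n
n≤2^n (suc n) = +-mono-≤ (m^n>0 2 n) (≤-trans (n≤2^n n) (m≤m+n (2 ^ n) 0))

E≤2^ : ∀ K → E K K ≤ 2 ^ (suc K + 2 * K)
E≤2^ K = begin
  2 ^ suc K * 3 ^ K       ≤⟨ *-monoʳ-≤ (2 ^ suc K) (^-monoˡ-≤ K (n≤1+n 3)) ⟩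
  2 ^ suc K * 4 ^ K       ≡⟨ cong (2 ^ suc K *_) (^-*-assoc 2 2 K) ⟩
  2 ^ suc K * 2 ^ (2 * K) ≡⟨ ^-distribˡ-+-* 2 (suc K) (2 * K) ⟨
  2 ^ (suc K + 2 * K)     ∎
  where open ≤-Reasoning

corollary1 : ∀ (C : ℕ) → ∃[ n ] (n ≥ 1 × C * f n < f (2 * n))
corollary1 C = fromInj₁ (λ f≤C^J → ⊥-elim (<-irrefl refl (2^[K*K]<2^[K*K] f≤C^J))) (doubling-or-bound C J)
  where
  K = 3 * C + 1
  J = suc K + 2 * K
  expand : ∀ c → c * ((1 + (3 * c + 1)) + 2 * (3 * c + 1)) + (1 + 2 * c) ≡ (3 * c + 1) * (3 * c + 1)
  expand = solve-∀
  CJ<K*K : C * J < K * K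
  CJ<K*K = subst (C * J <_) (expand C) (m<m+n (C * J) z<s)
  2^[K*K]<2^[K*K] : f (2 ^ J) ≤ C ^ J → 2 ^ (K * K) < 2 ^ (K * K)
  2^[K*K]<2^[K*K] f≤C^J = begin-strict
    2 ^ (K * K)     ≤⟨ 2^[K*K]≤τ[Mer[E]] K ⟩
    τ (Mer (E K K)) ≤⟨ τ[Mer]≤f (E>0 K K) (E≤2^ K) ⟩
    f (2 ^ J)       ≤⟨ f≤C^J ⟩
    C ^ J           ≤⟨ ^-monoˡ-≤ J (n≤2^n C) ⟩
    (2 ^ C) ^ J     ≡⟨ ^-*-assoc 2 C J ⟩
    2 ^ (C * J)     <⟨ ^-monoʳ-< 2 (s≤s (s≤s z≤n)) CJ<K*K ⟩
    2 ^ (K * K)     ∎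
    where open ≤-Reasoning
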